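{- Suppose that the sequent $\Gamma ~|~ \gamma \vdash \phi$ is provable in the proof system described below. Then it is valid.
   Context: Variables are split into a countably infinite set of parameter variables $p_1, p_2, \ldots$ and the remaining team variables. $\mathrm{Free}_P(\phi)$ and $\mathrm{Free}_T(\phi)$ denote the free parameter variables and the free team variables of $\phi$. Independence logic formulas are in negation normal form. They are built from first-order literals and independence atoms $\bar t_2 \perp_{\bar t_1} \bar t_3$, where $\bar t_i$ are tuples of terms, using $\wedge$, $\vee$, $\exists x$ and $\forall x$. They contain no parameter variables. Entailment semantics. Let $M$ be a first-order structure, $\gamma$ a first-order formula, and $h$ a parameter assignment whose domain contains $\mathrm{Free}_P(\gamma)$. The relation $M \models_{\gamma(h)} \phi$ is defined as follows. (lit) $\phi$ is a literal and every assignment $s$ of team variables (with domain $\mathrm{Free}_T(\gamma)\cup\mathrm{Free}_T(\phi)$) such that $M\models_{h\cup s}\gamma$ satisfies $M\models_s\phi$. (ind) $\phi$ is $\bar t_2\perp_{\bar t_1}\bar t_3$, and for all such $s,s'$ with $M\models_{h\cup s}\gamma$, $M\models_{h\cup s'}\gamma$ and $\bar t_1\langle s\rangle=\bar t_1\langle s'\rangle$, there is $s''$ with $M\models_{h\cup s''}\gamma$, $\bar t_1\bar t_2\langle s''\rangle=\bar t_1\bar t_2\langle s\rangle$ and $\bar t_1\bar t_3\langle s''\rangle=\bar t_1\bar t_3\langle s'\rangle$. ($\vee$) $\phi=\psi_1\vee\psi_2$, and there are a parameter assignment $h'$ extending $h$ and first-order $\gamma_1,\gamma_2$ with parameters in $\mathrm{Dom}(h')$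 such that $M\models_{\gamma_1(h')}\psi_1$, $M\models_{\gamma_2(h')}\psi_2$ and $M\models_{h'}\forall\bar v(\gamma\leftrightarrow\gamma_1\vee\gamma_2)$. Here $\bar v$ lists the free team variables of $\gamma,\gamma_1,\gamma_2$. ($\wedge$) $M\models_{\gamma(h)}$ both conjuncts. ($\exists$) $\phi=\exists x\psi$, and there are $h'$ extending $h$ and a first-order $\gamma'$ with parameters in $\mathrm{Dom}(h')$ such that $M\models_{\gamma'(h')}\psi$ and $M\models_{h'}\forall\bar v(\exists x\gamma'\leftrightarrow\exists x\gamma)$. ($\forall$) $\phi=\forall x\psi$, and there are $h'$ extending $h$ and a first-order $\gamma'$ such that $M\models_{\gamma'(h')}\psi$ and $M\models_{h'}\forall\bar v(\gamma'\leftrightarrow\exists x\gamma)$. Sequents. A sequent $\Gamma ~|~ \gamma\vdash\phi$ consists of: - a finite set $\Gamma$ of first-order formulas whose free variables are parameter variables; - a first-order formula $\gamma$; - an independence logic formula $\phi$. The sequent is valid iff for every structure $M$ and every parameter assignment $h$ with domain $\mathrm{Free}_P(\Gamma)\cup\mathrm{Free}_P(\gamma)$ such that $M\models_h\Gamma$, we have $M\models_{\gamma(h)}\phi$. Proof system. In each axiom and rule, $\bar v$ denotes the relevant free team variables. Axioms: - PS-lit: $\forall\bar v(\gamma\to\phi) ~|~ \gamma\vdash\phi$, for a literal $\phi$ without parameter variables. - PS-ind: $\forall\bar v_1\bar v_2((\gamma(\bar v_1)\wedge\gamma(\bar v_2)\wedge\bar t_1(\bar v_1)=\bar t_1(\bar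 v_2))\to\exists\bar v_3(\gamma(\bar v_3)\wedge\bar t_1\bar t_2(\bar v_3)=\bar t_1\bar t_2(\bar v_1)\wedge\bar t_1\bar t_3(\bar v_3)=\bar t_1\bar t_3(\bar v_2))) ~|~ \gamma\vdash\bar t_2\perp_{\bar t_1}\bar t_3$, for terms without parameter variables. Rules: - PS-$\vee$: from $\Gamma_1~|~\gamma_1\vdash\phi_1$ and $\Gamma_2~|~\gamma_2\vdash\phi_2$ infer $\Gamma_1,\Gamma_2,\forall\bar v(\gamma\leftrightarrow\gamma_1\vee\gamma_2)~|~\gamma\vdash\phi_1\vee\phi_2$. - PS-$\wedge$: from $\Gamma_1~|~\gamma\vdash\phi_1$ and $\Gamma_2~|~\gamma\vdash\phi_2$ infer $\Gamma_1,\Gamma_2~|~\gamma\vdash\phi_1\wedge\phi_2$. - PS-$\exists$: from $\Gamma~|~\gamma'\vdash\phi$ infer $\Gamma,\forall\bar v(\exists x\gamma'\leftrightarrow\exists x\gamma)~|~\gamma\vdash\exists x\phi$, for a team variable $x$. - PS-$\forall$: from $\Gamma~|~\gamma'\vdash\phi$ infer $\Gamma,\forall\bar v(\gamma'\leftrightarrow\exists x\gamma)~|~\gamma\vdash\forall x\phi$, for a team variable $x$. - PS-ent: from $\Gamma~|~\gamma\vdash\phi$ and $\bigwedge\Gamma'\models\bigwedge\Gamma$ in first-order logic infer $\Gamma'~|~\gamma\vdash\phi$. - PS-depar: from $\Gamma~|~\gamma\vdash\phi$ infer $\exists p\bigwedge\Gamma~|~\gamma\vdash\phi$, for a parameter variable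 $p$ not free in $\gamma$. - PS-split: from $\Gamma_1~|~\gamma\vdash\phi$ and $\Gamma_2~|~\gamma\vdash\phi$ infer $(\bigwedge\Gamma_1)\vee(\bigwedge\Gamma_2)~|~\gamma\vdash\phi$. A proof is a finite list of sequents, each of which is an axiom or follows from earlier ones by one rule. -}

module Defs where

open import Data.Nat using (ℕ; zero; suc; _+_; _*_; _⊔_)
open import Data.Nat.Properties using () renaming (_≟_ to _≟ℕ_)
open import Data.Bool using (Bool; true; false; if_then_else_)
open import Data.List using (List; []; _∷_; _++_; map; foldr; concatMap)
open import Data.List.Membership.Propositional using (_∈_; _∉_)
open import Data.List.Relation.Binary.Subset.Propositional using (_⊆_)
open import Data.Vec using (Vec; []; _∷_)
open import Data.Product using (Σ; _×_; _,_)
open import Data.Sum using (_⊎_)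
open import Data.Unit using (⊤)
open import Data.Empty using (⊥)
open import Relation.Nullary using (¬_; yes; no)
open import Relation.Binary.PropositionalEquality using (_≡_)

record Signature : Set₁ where
  field
    Fn    : Set
    Rel   : Set
    fnAr  : Fn → ℕ
    relAr : Rel → ℕ

module Syntax (S : Signature) where
  open Signature S

  data Term (V : Set) : Set where
    var : V → Term V
    app : (f : Fn) → Vec (Term V) (fnAr f) → Term V

  mutual
    tmap : ∀ {V W : Set} → (V → W) → Term V → Term W
    tmap g (var v)    = var (g v)
    tmap g (app f ts) = app f (tmapV g ts)

    tmapV : ∀ {V W : Set} {n} → (V → W) → Vec (Term V) n → Vec (Term W) n
    tmapV g []       = []
    tmapV g (t ∷ ts) = tmap g t ∷ tmapV g ts

  mutual
    tvars : ∀ {V : Set} → Term V → List V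
    tvars (var v)    = v ∷ []
    tvars (app f ts) = tvarsV ts

    tvarsV : ∀ {V : Set} {n} → Vec (Term V) n → List V
    tvarsV []       = []
    tvarsV (t ∷ ts) = tvars t ++ tvarsV ts

  -- Variables: parameter variables (par i) and team variables (tm i)

  data Var : Set where
    par : ℕ → Var
    tm  : ℕ → Var

  sameVar : Var → Var → Bool
  sameVar (par m) (par n) with m ≟ℕ n
  ... | yes _ = true
  ... | no _  = false
  sameVar (tm m) (tm n) with m ≟ℕ n
  ... | yes _ = true
  ... | no _  = false
  sameVar _ _ = false

  data Fm : Set where
    tt ff : Fm
    eq    : Term Var → Term Var → Fm
    rel   : (R : Rel) → Vec (Term Var) (relAr R) → Fm
    neg   : Fm → Fm
    and or imp iff : Fm → Fm → Fm
    all ex : Var → Fm → Fm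

  del : Var → List Var → List Var
  del v []       = []
  del v (w ∷ ws) = if sameVar v w then del v ws else w ∷ del v ws

  fv : Fm → List Var
  fv tt         = []
  fv ff         = []
  fv (eq t u)   = tvars t ++ tvars u
  fv (rel R ts) = tvarsV ts
  fv (neg φ)    = fv φ
  fv (and φ ψ)  = fv φ ++ fv ψ
  fv (or φ ψ)   = fv φ ++ fv ψ
  fv (imp φ ψ)  = fv φ ++ fv ψ
  fv (iff φ ψ)  = fv φ ++ fv ψ
  fv (all v φ)  = del v (fv φ)
  fv (ex v φ)   = del v (fv φ)

  parsOf : List Var → List ℕ
  parsOf []            = []
  parsOf (par p ∷ vs)  = p ∷ parsOf vs
  parsOf (tm _ ∷ vs)   = parsOf vs

  teamsOf : List Var → List ℕ
  teamsOf []           = []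
  teamsOf (par _ ∷ vs) = teamsOf vs
  teamsOf (tm x ∷ vs)  = x ∷ teamsOf vs

  fvP : Fm → List ℕ
  fvP φ = parsOf (fv φ)

  fvT : Fm → List ℕ
  fvT φ = teamsOf (fv φ)

  allT : Fm → List ℕ
  allT tt         = []
  allT ff         = []
  allT (eq t u)   = teamsOf (tvars t ++ tvars u)
  allT (rel R ts) = teamsOf (tvarsV ts)
  allT (neg φ)    = allT φ
  allT (and φ ψ)  = allT φ ++ allT ψ
  allT (or φ ψ)   = allT φ ++ allT ψ
  allT (imp φ ψ)  = allT φ ++ allT ψ
  allT (iff φ ψ)  = allT φ ++ allT ψ
  allT (all v φ)  = teamsOf (v ∷ []) ++ allT φ
  allT (ex v φ)   = teamsOf (v ∷ []) ++ allT φ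

  -- renaming of every team variable x (free and bound) to x + k;
  -- being injective, this renaming is capture-free
  shV : ℕ → Var → Var
  shV k (par p) = par p
  shV k (tm x)  = tm (x + k)

  shF : ℕ → Fm → Fm
  shF k tt         = tt
  shF k ff         = ff
  shF k (eq t u)   = eq (tmap (shV k) t) (tmap (shV k) u)
  shF k (rel R ts) = rel R (tmapV (shV k) ts)
  shF k (neg φ)    = neg (shF k φ)
  shF k (and φ ψ)  = and (shF k φ) (shF k ψ)
  shF k (or φ ψ)   = or (shF k φ) (shF k ψ)
  shF k (imp φ ψ)  = imp (shF k φ) (shF k ψ)
  shF k (iff φ ψ)  = iff (shF k φ) (shF k ψ)
  shF k (all v φ)  = all (shV k v) (shF k φ)
  shF k (ex v φ)   = ex (shV k v) (shF k φ)

  conj : List Fm → Fm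
  conj = foldr and tt

  closeT : Fm → Fm
  closeT φ = foldr (λ x ψ → all (tm x) ψ) φ (fvT φ)

  exsT : List ℕ → Fm → Fm
  exsT xs φ = foldr (λ x ψ → ex (tm x) ψ) φ xs

  eqs : List (Term Var) → List (Term Var) → Fm
  eqs (a ∷ as) (b ∷ bs) = and (eq a b) (eqs as bs)
  eqs _        _        = tt

  -- Independence logic formulas (negation normal form, no parameter
  -- variables: their terms only use team variables, indexed by ℕ)

  data Lit : Set where
    eqL neqL   : Term ℕ → Term ℕ → Lit
    relL nrelL : (R : Rel) → Vec (Term ℕ) (relAr R) → Lit

  data IL : Set where
    lit   : Lit → IL
    -- indep t̄₁ t̄₂ t̄₃ is the independence atom  t̄₂ ⊥_{t̄₁} t̄₃
    indep : (t₁ t₂ t₃ : List (Term ℕ)) → IL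
    andI orI : IL → IL → IL
    exI allI : ℕ → IL → IL

  embT : Term ℕ → Term Var
  embT = tmap tm

  litFm : Lit → Fm
  litFm (eqL t u)    = eq (embT t) (embT u)
  litFm (neqL t u)   = neg (eq (embT t) (embT u))
  litFm (relL R ts)  = rel R (tmapV tm ts)
  litFm (nrelL R ts) = neg (rel R (tmapV tm ts))

  -- The Γ-formula of axiom PS-ind.  γ(v̄ᵢ), t̄(v̄ᵢ) are realised by
  -- renaming all team variables x to x + i·N, where N exceeds every team
  -- variable occurring in γ and the terms (so the copies are disjoint).

  maxL : List ℕ → ℕ
  maxL = foldr _⊔_ 0

  indAx : Fm → (t₁ t₂ t₃ : List (Term ℕ)) → Fm
  indAx γ t₁ t₂ t₃ = closeT body
    where
      tv : List ℕ
      tv = concatMap tvars (t₁ ++ t₂ ++ t₃)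
      vs : List ℕ
      vs = fvT γ ++ tv
      N : ℕ
      N = suc (maxL (allT γ ++ tv))
      cp : ℕ → Fm
      cp i = shF (i * N) γ
      ct : ℕ → List (Term ℕ) → List (Term Var)
      ct i = map (λ t → tmap (shV (i * N)) (embT t))
      body : Fm
      body = imp (and (cp 1) (and (cp 2) (eqs (ct 1 t₁) (ct 2 t₁))))
                 (exsT (map (λ x → x + 3 * N) vs)
                   (and (cp 3)
                     (and (eqs (ct 3 (t₁ ++ t₂)) (ct 1 (t₁ ++ t₂)))
                          (eqs (ct 3 (t₁ ++ t₃)) (ct 2 (t₁ ++ t₃))))))

  record Structure : Set₁ where
    field
      Carrier : Set
      point   : Carrier
      interpF : (f : Fn) → Vec Carrier (fnAr f) → Carrier
      interpR : (R : Rel) → Vec Carrier (relAr R) → Set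

  module _ (M : Structure) where
    open Structure M

    mutual
      eval : ∀ {V : Set} → (V → Carrier) → Term V → Carrier
      eval ρ (var v)    = ρ v
      eval ρ (app f ts) = interpF f (evalV ρ ts)

      evalV : ∀ {V : Set} {n} → (V → Carrier) → Vec (Term V) n → Vec Carrier n
      evalV ρ []       = []
      evalV ρ (t ∷ ts) = eval ρ t ∷ evalV ρ ts

    update : (Var → Carrier) → Var → Carrier → Var → Carrier
    update ρ v a w = if sameVar v w then a else ρ w

    Sat : (Var → Carrier) → Fm → Set
    Sat ρ tt         = ⊤
    Sat ρ ff         = ⊥
    Sat ρ (eq t u)   = eval ρ t ≡ eval ρ u
    Sat ρ (rel R ts) = interpR R (evalV ρ ts)
    Sat ρ (neg φ)    = ¬ Sat ρ φ
    Sat ρ (and φ ψ)  = Sat ρ φ × Sat ρ ψ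
    Sat ρ (or φ ψ)   = Sat ρ φ ⊎ Sat ρ ψ
    Sat ρ (imp φ ψ)  = Sat ρ φ → Sat ρ ψ
    Sat ρ (iff φ ψ)  = (Sat ρ φ → Sat ρ ψ) × (Sat ρ ψ → Sat ρ φ)
    Sat ρ (all v φ)  = (a : Carrier) → Sat (update ρ v a) φ
    Sat ρ (ex v φ)   = Σ Carrier (λ a → Sat (update ρ v a) φ)

    record PAssign : Set where
      field
        dom : List ℕ
        val : ℕ → Carrier
    open PAssign

    env : PAssign → (ℕ → Carrier) → Var → Carrier
    env h s (par p) = val h p
    env h s (tm x)  = s x

    SatP : PAssign → Fm → Set
    SatP h θ = (s : ℕ → Carrier) → Sat (env h s) θ

    Extends : PAssign → PAssign → Set
    Extends h h' = (dom h ⊆ dom h') × ((p : ℕ) → p ∈ dom h → val h' p ≡ val h p)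

    LitSat : (ℕ → Carrier) → Lit → Set
    LitSat s (eqL t u)    = eval s t ≡ eval s u
    LitSat s (neqL t u)   = ¬ (eval s t ≡ eval s u)
    LitSat s (relL R ts)  = interpR R (evalV s ts)
    LitSat s (nrelL R ts) = ¬ interpR R (evalV s ts)

    evs : (ℕ → Carrier) → List (Term ℕ) → List Carrier
    evs s = map (eval s)

    Ent : Fm → PAssign → IL → Set
    Ent γ h (lit l) =
      (s : ℕ → Carrier) → Sat (env h s) γ → LitSat s l
    Ent γ h (indep t₁ t₂ t₃) =
      (s s' : ℕ → Carrier) → Sat (env h s) γ → Sat (env h s') γ →
      evs s t₁ ≡ evs s' t₁ →
      Σ (ℕ → Carrier) λ s'' → Sat (env h s'') γ
        × evs s'' (t₁ ++ t₂) ≡ evs s (t₁ ++ t₂)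
        × evs s'' (t₁ ++ t₃) ≡ evs s' (t₁ ++ t₃)
    Ent γ h (orI ψ₁ ψ₂) =
      Σ PAssign λ h' → Extends h h' × Σ Fm λ γ₁ → Σ Fm λ γ₂ →
        fvP γ₁ ⊆ dom h' × fvP γ₂ ⊆ dom h'
        × Ent γ₁ h' ψ₁ × Ent γ₂ h' ψ₂
        × SatP h' (closeT (iff γ (or γ₁ γ₂)))
    Ent γ h (andI ψ₁ ψ₂) = Ent γ h ψ₁ × Ent γ h ψ₂
    Ent γ h (exI x ψ) =
      Σ PAssign λ h' → Extends h h' × Σ Fm λ γ' →
        fvP γ' ⊆ dom h' × Ent γ' h' ψ
        × SatP h' (closeT (iff (ex (tm x) γ') (ex (tm x) γ)))
    Ent γ h (allI x ψ) =
      Σ PAssign λ h' → Extends h h' × Σ Fm λ γ' →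
        fvP γ' ⊆ dom h' × Ent γ' h' ψ
        × SatP h' (closeT (iff γ' (ex (tm x) γ)))

  open PAssign

  FOEnt : Fm → Fm → Set₁
  FOEnt φ ψ = (M : Structure) (ρ : Var → Structure.Carrier M) → Sat M ρ φ → Sat M ρ ψ

  Valid : List Fm → Fm → IL → Set₁
  Valid Γ γ φ =
    (M : Structure) (h : PAssign M) →
    dom h ≡ fvP (conj Γ) ++ fvP γ →
    SatP M h (conj Γ) → Ent M γ h φ

  data _∣_⊢_ : List Fm → Fm → IL → Set₁ where
    ps-lit   : (γ : Fm) (l : Lit) →
               (closeT (imp γ (litFm l)) ∷ []) ∣ γ ⊢ lit l
    ps-ind   : (γ : Fm) (t₁ t₂ t₃ : List (Term ℕ)) →
               (indAx γ t₁ t₂ t₃ ∷ []) ∣ γ ⊢ indep t₁ t₂ t₃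
    ps-or    : ∀ {Γ₁ Γ₂ γ₁ γ₂ φ₁ φ₂} (γ : Fm) →
               Γ₁ ∣ γ₁ ⊢ φ₁ → Γ₂ ∣ γ₂ ⊢ φ₂ →
               (Γ₁ ++ Γ₂ ++ (closeT (iff γ (or γ₁ γ₂)) ∷ [])) ∣ γ ⊢ orI φ₁ φ₂
    ps-and   : ∀ {Γ₁ Γ₂ γ φ₁ φ₂} →
               Γ₁ ∣ γ ⊢ φ₁ → Γ₂ ∣ γ ⊢ φ₂ → (Γ₁ ++ Γ₂) ∣ γ ⊢ andI φ₁ φ₂
    ps-ex    : ∀ {Γ γ' φ} (γ : Fm) (x : ℕ) →
               Γ ∣ γ' ⊢ φ →
               (Γ ++ (closeT (iff (ex (tm x) γ') (ex (tm x) γ)) ∷ [])) ∣ γ ⊢ exI x φ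
    ps-all   : ∀ {Γ γ' φ} (γ : Fm) (x : ℕ) →
               Γ ∣ γ' ⊢ φ →
               (Γ ++ (closeT (iff γ' (ex (tm x) γ)) ∷ [])) ∣ γ ⊢ allI x φ
    ps-ent   : ∀ {Γ γ φ} (Γ' : List Fm) →
               Γ ∣ γ ⊢ φ →
               fvT (conj Γ') ≡ [] →
               FOEnt (conj Γ') (conj Γ) →
               Γ' ∣ γ ⊢ φ
    ps-depar : ∀ {Γ γ φ} (p : ℕ) →
               Γ ∣ γ ⊢ φ → p ∉ fvP γ →
               (ex (par p) (conj Γ) ∷ []) ∣ γ ⊢ φ
    ps-split : ∀ {Γ₁ Γ₂ γ φ} →
               Γ₁ ∣ γ ⊢ φ → Γ₂ ∣ γ ⊢ φ →
               (or (conj Γ₁) (conj Γ₂) ∷ []) ∣ γ ⊢ φ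

module Submission where

-- At every disjunction and quantifier the entailment semantics asks for ONE
-- parameter assignment h' extending h under which all witnessing formulas are
-- read.  Soundness is much easier for a relaxed semantics  TeamEnt T φ,  in
-- which the team T is an arbitrary predicate on team assignments and every
-- witnessing team comes with a parameter assignment of its own.

open import Defs
open import Data.Nat using (ℕ; suc; _+_; _*_; _∸_; _≤_; _<_; s≤s)
open import Data.Nat.Properties
  using ( +-cancelʳ-≡; m≤m+n; m≤n+m; m≤m⊔n; m≤n⊔m; ≤-trans; <-≤-trans; m+n∸n≡m; +-monoˡ-<
        ; _<?_; ≤⇒≯)
  renaming (_≟_ to _≟ℕ_)
open import Data.Bool using (true; false; if_then_else_)
open import Data.List using (List; []; _∷_; _++_; map; foldr; concatMap)
open import Data.List.Properties using (map-cong-local; ∷-injective)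
open import Data.List.Membership.Propositional using (_∈_; _∉_; lose)
open import Data.List.Membership.Propositional.Properties
  using (∈-++⁺ˡ; ∈-++⁺ʳ; ∈-++⁻; ∈-map⁻; ∈-concatMap⁺)
open import Data.List.Relation.Binary.Subset.Propositional using (_⊆_)
open import Data.List.Relation.Unary.Any using (here; there)
import Data.List.Relation.Unary.All as All
open import Data.Vec using (Vec; []; _∷_)
open import Data.Product using (Σ; _×_; _,_; proj₁; proj₂)
open import Data.Product.Function.NonDependent.Propositional using (_×-⇔_)
open import Data.Sum using (_⊎_; inj₁; inj₂; [_,_]′)
open import Data.Sum.Function.Propositional using (_⊎-⇔_)
open import Data.Unit using (tt)
open import Data.Empty using (⊥-elim)
open import Function using (_∘_)
open import Function.Bundles using (_⇔_; mk⇔; Equivalence)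
open import Function.Definitions using (Injective)
import Function.Properties.Equivalence as ⇔
open import Function.Related.TypeIsomorphisms using (→-cong-⇔; ¬-cong-⇔)
open import Level using (0ℓ)
import Relation.Binary.Reasoning.Setoid as SetoidReasoning
open import Relation.Nullary using (yes; no)
open import Relation.Nullary.Reflects using (Reflects; ofʸ; ofⁿ)
open import Relation.Binary.PropositionalEquality
  using (_≡_; _≢_; refl; sym; trans; cong; cong₂; subst; module ≡-Reasoning)

open Equivalence using (to; from)

module ⇔-Reasoning = SetoidReasoning (⇔.⇔-setoid 0ℓ)

≡⇒⇔ : {A B : Set} → A ≡ B → A ⇔ B
≡⇒⇔ refl = ⇔.refl

Π-cong-⇔ : {A : Set} {P Q : A → Set} → (∀ a → P a ⇔ Q a) → ((a : A) → P a) ⇔ ((a : A) → Q a)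
Π-cong-⇔ e = mk⇔ (λ f a → to (e a) (f a)) (λ g a → from (e a) (g a))

Σ-cong-⇔ : {A : Set} {P Q : A → Set} → (∀ a → P a ⇔ Q a) → Σ A P ⇔ Σ A Q
Σ-cong-⇔ e = mk⇔ (λ (a , p) → a , to (e a) p) (λ (a , q) → a , from (e a) q)

∈-++-map : {A B : Set} {a : A} {b : B} {xs ys : List A} {xs' ys' : List B} →
           (a ∈ xs → b ∈ xs') → (a ∈ ys → b ∈ ys') → a ∈ xs ++ ys → b ∈ xs' ++ ys'
∈-++-map {xs = xs} {xs' = xs'} f g m = [ ∈-++⁺ˡ ∘ f , ∈-++⁺ʳ xs' ∘ g ]′ (∈-++⁻ xs m)

∉-++ : {A : Set} {a : A} {xs ys : List A} → a ∉ xs → a ∉ ys → a ∉ xs ++ ys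
∉-++ {xs = xs} a∉xs a∉ys m = [ a∉xs , a∉ys ]′ (∈-++⁻ xs m)

merge3 : {A : Set} → ℕ → (a b c : ℕ → A) → ℕ → A
merge3 K a b c q with q <? K | q <? 2 * K
... | yes _ | _     = a q
... | no _  | yes _ = b (q ∸ 1 * K)
... | no _  | no _  = c (q ∸ 2 * K)

module _ {A : Set} (K : ℕ) (a b c : ℕ → A) {q : ℕ} (q<K : q < K) where

  merge3-first : merge3 K a b c q ≡ a q
  merge3-first with q <? K
  ... | yes _  = refl
  ... | no q≮K = ⊥-elim (q≮K q<K)

  merge3-second : merge3 K a b c (q + 1 * K) ≡ b q
  merge3-second with q + 1 * K <? K | q + 1 * K <? 2 * K
  ... | yes lt | _      = ⊥-elim (≤⇒≯ (≤-trans (m≤m+n K 0) (m≤n+m (1 * K) q)) lt)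
  ... | no _   | yes _  = cong b (m+n∸n≡m q (1 * K))
  ... | no _   | no ¬lt = ⊥-elim (¬lt (+-monoˡ-< (1 * K) q<K))

  merge3-third : merge3 K a b c (q + 2 * K) ≡ c q
  merge3-third with q + 2 * K <? K | q + 2 * K <? 2 * K
  ... | yes lt | _      = ⊥-elim (≤⇒≯ (≤-trans (m≤m+n K (1 * K)) (m≤n+m (2 * K) q)) lt)
  ... | no _   | yes lt = ⊥-elim (≤⇒≯ (m≤n+m (2 * K) q) lt)
  ... | no _   | no _   = cong c (m+n∸n≡m q (2 * K))

module Soundness (S : Signature) where
  open Signature S
  open Syntax S
  open PAssign

  maxL-< : ∀ {x} xs → x ∈ xs → x < suc (maxL xs)
  maxL-< (y ∷ ys) (here refl) = s≤s (m≤m⊔n y (maxL ys))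
  maxL-< (y ∷ ys) (there m)   = ≤-trans (maxL-< ys m) (s≤s (m≤n⊔m y (maxL ys)))

  tm-injective : ∀ {x y} → tm x ≡ tm y → x ≡ y
  tm-injective refl = refl

  par-injective : ∀ {p q} → par p ≡ par q → p ≡ q
  par-injective refl = refl

  sameVar-reflects : ∀ v w → Reflects (v ≡ w) (sameVar v w)
  sameVar-reflects (par m) (par n) with m ≟ℕ n
  ... | yes refl = ofʸ refl
  ... | no m≢n   = ofⁿ (m≢n ∘ par-injective)
  sameVar-reflects (tm m) (tm n) with m ≟ℕ n
  ... | yes refl = ofʸ refl
  ... | no m≢n   = ofⁿ (m≢n ∘ tm-injective)
  sameVar-reflects (par m) (tm n) = ofⁿ λ ()
  sameVar-reflects (tm m) (par n) = ofⁿ λ ()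

  sameVar-refl : ∀ v → sameVar v v ≡ true
  sameVar-refl v with sameVar v v | sameVar-reflects v v
  ... | true  | _      = refl
  ... | false | ofⁿ ¬e = ⊥-elim (¬e refl)

  sameVar-≡ : ∀ {v w} → sameVar v w ≡ true → v ≡ w
  sameVar-≡ {v} {w} e with sameVar v w | sameVar-reflects v w
  sameVar-≡ e  | true  | ofʸ v≡w = v≡w
  sameVar-≡ () | false | _

  sameVar-≢ : ∀ {v w} → v ≢ w → sameVar v w ≡ false
  sameVar-≢ {v} {w} v≢w with sameVar v w | sameVar-reflects v w
  ... | true  | ofʸ v≡w = ⊥-elim (v≢w v≡w)
  ... | false | _       = refl

  sameVar-injective : ∀ {r} → Injective _≡_ _≡_ r → ∀ v w → sameVar (r v) (r w) ≡ sameVar v w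
  sameVar-injective {r} inj v w with sameVar v w | sameVar-reflects v w
  ... | true  | ofʸ refl = sameVar-refl (r v)
  ... | false | ofⁿ v≢w  = sameVar-≢ (v≢w ∘ inj)

  ∈-del⁻ : ∀ {v w} xs → w ∈ del v xs → w ∈ xs × sameVar v w ≡ false
  ∈-del⁻ {v} (x ∷ xs) m with sameVar v x in e
  ∈-del⁻ (x ∷ xs) m           | true  = let (w∈xs , ne) = ∈-del⁻ xs m in there w∈xs , ne
  ∈-del⁻ (x ∷ xs) (here refl) | false = here refl , e
  ∈-del⁻ (x ∷ xs) (there m)   | false = let (w∈xs , ne) = ∈-del⁻ xs m in there w∈xs , ne

  ∈-del⁺ : ∀ {v w} xs → w ∈ xs → sameVar v w ≡ false → w ∈ del v xs
  ∈-del⁺ {v} (x ∷ xs) m ne with sameVar v x in e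
  ∈-del⁺ (x ∷ xs) (here refl) ne | true with () ← trans (sym e) ne
  ∈-del⁺ (x ∷ xs) (there m) ne   | true  = ∈-del⁺ xs m ne
  ∈-del⁺ (x ∷ xs) (here refl) ne | false = here refl
  ∈-del⁺ (x ∷ xs) (there m) ne   | false = there (∈-del⁺ xs m ne)

  teamsOf-∈ : ∀ {x} vs → tm x ∈ vs → x ∈ teamsOf vs
  teamsOf-∈ (tm _ ∷ vs)  (here refl) = here refl
  teamsOf-∈ (par _ ∷ vs) (there m)   = teamsOf-∈ vs m
  teamsOf-∈ (tm _ ∷ vs)  (there m)   = there (teamsOf-∈ vs m)

  parsOf-∈ : ∀ {p} vs → par p ∈ vs → p ∈ parsOf vs
  parsOf-∈ (par _ ∷ vs) (here refl) = here refl
  parsOf-∈ (par _ ∷ vs) (there m)   = there (parsOf-∈ vs m)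
  parsOf-∈ (tm _ ∷ vs)  (there m)   = parsOf-∈ vs m

  fv⊆allT : ∀ φ {x} → tm x ∈ fv φ → x ∈ allT φ
  fv⊆allT (eq t u)   m = teamsOf-∈ (tvars t ++ tvars u) m
  fv⊆allT (rel R ts) m = teamsOf-∈ (tvarsV ts) m
  fv⊆allT (neg φ)    m = fv⊆allT φ m
  fv⊆allT (and φ ψ)  m = ∈-++-map (fv⊆allT φ) (fv⊆allT ψ) m
  fv⊆allT (or φ ψ)   m = ∈-++-map (fv⊆allT φ) (fv⊆allT ψ) m
  fv⊆allT (imp φ ψ)  m = ∈-++-map (fv⊆allT φ) (fv⊆allT ψ) m
  fv⊆allT (iff φ ψ)  m = ∈-++-map (fv⊆allT φ) (fv⊆allT ψ) m
  fv⊆allT (all v φ)  m = ∈-++⁺ʳ (teamsOf (v ∷ [])) (fv⊆allT φ (proj₁ (∈-del⁻ (fv φ) m)))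
  fv⊆allT (ex v φ)   m = ∈-++⁺ʳ (teamsOf (v ∷ [])) (fv⊆allT φ (proj₁ (∈-del⁻ (fv φ) m)))

  fv-conj-++ : ∀ xs ys {w} → w ∈ fv (conj (xs ++ ys)) → w ∈ fv (conj xs) ++ fv (conj ys)
  fv-conj-++ []       ys m = ∈-++⁺ʳ [] m
  fv-conj-++ (x ∷ xs) ys m =
    [ ∈-++⁺ˡ ∘ ∈-++⁺ˡ
    , ∈-++-map (∈-++⁺ʳ (fv x)) (λ m' → m') ∘ fv-conj-++ xs ys
    ]′ (∈-++⁻ (fv x) m)

  ren : (Var → Var) → Fm → Fm
  ren r tt         = tt
  ren r ff         = ff
  ren r (eq t u)   = eq (tmap r t) (tmap r u)
  ren r (rel R ts) = rel R (tmapV r ts)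
  ren r (neg φ)    = neg (ren r φ)
  ren r (and φ ψ)  = and (ren r φ) (ren r ψ)
  ren r (or φ ψ)   = or (ren r φ) (ren r ψ)
  ren r (imp φ ψ)  = imp (ren r φ) (ren r ψ)
  ren r (iff φ ψ)  = iff (ren r φ) (ren r ψ)
  ren r (all v φ)  = all (r v) (ren r φ)
  ren r (ex v φ)   = ex (r v) (ren r φ)

  shF≡ren : ∀ k φ → shF k φ ≡ ren (shV k) φ
  shF≡ren k tt         = refl
  shF≡ren k ff         = refl
  shF≡ren k (eq t u)   = refl
  shF≡ren k (rel R ts) = refl
  shF≡ren k (neg φ)    = cong neg (shF≡ren k φ)
  shF≡ren k (and φ ψ)  = cong₂ and (shF≡ren k φ) (shF≡ren k ψ)
  shF≡ren k (or φ ψ)   = cong₂ or (shF≡ren k φ) (shF≡ren k ψ)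
  shF≡ren k (imp φ ψ)  = cong₂ imp (shF≡ren k φ) (shF≡ren k ψ)
  shF≡ren k (iff φ ψ)  = cong₂ iff (shF≡ren k φ) (shF≡ren k ψ)
  shF≡ren k (all v φ)  = cong (all (shV k v)) (shF≡ren k φ)
  shF≡ren k (ex v φ)   = cong (ex (shV k v)) (shF≡ren k φ)

  shV-injective : ∀ k → Injective _≡_ _≡_ (shV k)
  shV-injective k {tm x}  {tm y}  e    = cong tm (+-cancelʳ-≡ k x y (tm-injective e))
  shV-injective k {par p} {par q} refl = refl

  shP : ℕ → Var → Var
  shP k (par p) = par (p + k)
  shP k (tm x)  = tm x

  shP-injective : ∀ k → Injective _≡_ _≡_ (shP k)
  shP-injective k {par p} {par q} e    = cong par (+-cancelʳ-≡ k p q (par-injective e))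
  shP-injective k {tm x}  {tm y}  refl = refl

  allsT : List ℕ → Fm → Fm
  allsT xs φ = foldr (λ x ψ → all (tm x) ψ) φ xs

  fv-allsT : ∀ xs ψ {w} → w ∈ fv (allsT xs ψ) →
             w ∈ fv ψ × (∀ {x} → x ∈ xs → sameVar (tm x) w ≡ false)
  fv-allsT []       ψ m = m , λ ()
  fv-allsT (x ∷ xs) ψ m =
    let (m₁ , ne)  = ∈-del⁻ (fv (allsT xs ψ)) m
        (m₂ , ne') = fv-allsT xs ψ m₁
    in m₂ , λ { (here refl) → ne ; (there k) → ne' k }

  TeamClosed : Fm → Set
  TeamClosed φ = ∀ {x} → tm x ∉ fv φ

  closeT-closed : ∀ ψ → TeamClosed (closeT ψ)
  closeT-closed ψ {x} m with fv-allsT (fvT ψ) ψ m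
  ... | m' , ne with () ← trans (sym (sameVar-refl (tm x))) (ne (teamsOf-∈ (fv ψ) m'))

  single-closed : ∀ φ → TeamClosed φ → TeamClosed (conj (φ ∷ []))
  single-closed φ c = ∉-++ c λ ()

  closeT-single-closed : ∀ ψ → TeamClosed (conj (closeT ψ ∷ []))
  closeT-single-closed ψ = single-closed (closeT ψ) (closeT-closed ψ)

  conj-++-closed : ∀ xs ys → TeamClosed (conj xs) → TeamClosed (conj ys) → TeamClosed (conj (xs ++ ys))
  conj-++-closed xs ys cx cy m = ∉-++ cx cy (fv-conj-++ xs ys m)

  module IndAx (γ : Fm) (t₁ t₂ t₃ : List (Term ℕ)) where
    terms : List (Term ℕ)
    terms = t₁ ++ t₂ ++ t₃

    tv : List ℕ
    tv = concatMap tvars terms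

    vs : List ℕ
    vs = fvT γ ++ tv

    N : ℕ
    N = suc (maxL (allT γ ++ tv))

    cp : ℕ → Fm
    cp i = shF (i * N) γ

    ct : ℕ → List (Term ℕ) → List (Term Var)
    ct i = map (λ t → tmap (shV (i * N)) (embT t))

    premise : Fm
    premise = and (cp 1) (and (cp 2) (eqs (ct 1 t₁) (ct 2 t₁)))

    conclusion : Fm
    conclusion = and (cp 3) (and (eqs (ct 3 (t₁ ++ t₂)) (ct 1 (t₁ ++ t₂)))
                                 (eqs (ct 3 (t₁ ++ t₃)) (ct 2 (t₁ ++ t₃))))

    body : Fm
    body = imp premise (exsT (map (λ x → x + 3 * N) vs) conclusion)

  context-closed : ∀ {Γ γ φ} → Γ ∣ γ ⊢ φ → TeamClosed (conj Γ)
  context-closed (ps-lit γ l) = closeT-single-closed (imp γ (litFm l))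
  context-closed (ps-ind γ t₁ t₂ t₃) = closeT-single-closed (IndAx.body γ t₁ t₂ t₃)
  context-closed (ps-or {Γ₁} {Γ₂} {γ₁} {γ₂} γ d e) =
    conj-++-closed Γ₁ _ (context-closed d)
      (conj-++-closed Γ₂ _ (context-closed e) (closeT-single-closed (iff γ (or γ₁ γ₂))))
  context-closed (ps-and {Γ₁} {Γ₂} d e) = conj-++-closed Γ₁ Γ₂ (context-closed d) (context-closed e)
  context-closed (ps-ex {Γ} {γ'} γ x d) =
    conj-++-closed Γ _ (context-closed d) (closeT-single-closed (iff (ex (tm x) γ') (ex (tm x) γ)))
  context-closed (ps-all {Γ} {γ'} γ x d) =
    conj-++-closed Γ _ (context-closed d) (closeT-single-closed (iff γ' (ex (tm x) γ)))
  context-closed (ps-ent Γ' d noTeam _) {x} m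
    with () ← subst (x ∈_) noTeam (teamsOf-∈ (fv (conj Γ')) m)
  context-closed (ps-depar {Γ} p d _) =
    single-closed (ex (par p) (conj Γ)) (context-closed d ∘ proj₁ ∘ ∈-del⁻ (fv (conj Γ)))
  context-closed (ps-split {Γ₁} {Γ₂} d e) =
    single-closed (or (conj Γ₁) (conj Γ₂)) (∉-++ (context-closed d) (context-closed e))

  module Semantics (M : Structure) where
    open Structure M

    Env : Set
    Env = Var → Carrier

    mutual
      eval-tmap : ∀ {V W : Set} (ρ : W → Carrier) (g : V → W) t → eval M ρ (tmap g t) ≡ eval M (ρ ∘ g) t
      eval-tmap ρ g (var v)    = refl
      eval-tmap ρ g (app f ts) = cong (interpF f) (evalV-tmap ρ g ts)

      evalV-tmap : ∀ {V W : Set} {n} (ρ : W → Carrier) (g : V → W) (ts : Vec (Term V) n) →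
                   evalV M ρ (tmapV g ts) ≡ evalV M (ρ ∘ g) ts
      evalV-tmap ρ g []       = refl
      evalV-tmap ρ g (t ∷ ts) = cong₂ _∷_ (eval-tmap ρ g t) (evalV-tmap ρ g ts)

    Agree : {V : Set} → List V → (V → Carrier) → (V → Carrier) → Set
    Agree xs ρ ρ' = ∀ w → w ∈ xs → ρ w ≡ ρ' w

    agree-l : ∀ {V : Set} {xs ys : List V} {ρ ρ'} → Agree (xs ++ ys) ρ ρ' → Agree xs ρ ρ'
    agree-l ag w m = ag w (∈-++⁺ˡ m)

    agree-r : ∀ {V : Set} {xs ys : List V} {ρ ρ'} → Agree (xs ++ ys) ρ ρ' → Agree ys ρ ρ'
    agree-r {xs = xs} ag w m = ag w (∈-++⁺ʳ xs m)

    agree-update : ∀ v a xs {ρ ρ'} → Agree (del v xs) ρ ρ' → Agree xs (update M ρ v a) (update M ρ' v a)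
    agree-update v a xs ag w m with sameVar v w in e
    ... | true  = refl
    ... | false = ag w (∈-del⁺ xs m e)

    mutual
      eval-cong : ∀ {V : Set} {ρ ρ' : V → Carrier} t → Agree (tvars t) ρ ρ' → eval M ρ t ≡ eval M ρ' t
      eval-cong (var v)    ag = ag v (here refl)
      eval-cong (app f ts) ag = cong (interpF f) (evalV-cong ts ag)

      evalV-cong : ∀ {V : Set} {n} {ρ ρ' : V → Carrier} (ts : Vec (Term V) n) →
                   Agree (tvarsV ts) ρ ρ' → evalV M ρ ts ≡ evalV M ρ' ts
      evalV-cong []       ag = refl
      evalV-cong (t ∷ ts) ag = cong₂ _∷_ (eval-cong t (agree-l ag)) (evalV-cong ts (agree-r {xs = tvars t} ag))

    coincidence : ∀ φ {ρ ρ'} → Agree (fv φ) ρ ρ' → Sat M ρ φ ⇔ Sat M ρ' φ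
    coincidence tt         ag = ⇔.refl
    coincidence ff         ag = ⇔.refl
    coincidence (eq t u)   ag = ≡⇒⇔ (cong₂ _≡_ (eval-cong t (agree-l ag)) (eval-cong u (agree-r {xs = tvars t} ag)))
    coincidence (rel R ts) ag = ≡⇒⇔ (cong (interpR R) (evalV-cong ts ag))
    coincidence (neg φ)    ag = ¬-cong-⇔ (coincidence φ ag)
    coincidence (and φ ψ)  ag = coincidence φ (agree-l ag) ×-⇔ coincidence ψ (agree-r {xs = fv φ} ag)
    coincidence (or φ ψ)   ag = coincidence φ (agree-l ag) ⊎-⇔ coincidence ψ (agree-r {xs = fv φ} ag)
    coincidence (imp φ ψ)  ag = →-cong-⇔ (coincidence φ (agree-l ag)) (coincidence ψ (agree-r {xs = fv φ} ag))
    coincidence (iff φ ψ)  ag = →-cong-⇔ φ⇔ ψ⇔ ×-⇔ →-cong-⇔ ψ⇔ φ⇔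
      where φ⇔ = coincidence φ (agree-l ag)
            ψ⇔ = coincidence ψ (agree-r {xs = fv φ} ag)
    coincidence (all v φ)  ag = Π-cong-⇔ λ a → coincidence φ (agree-update v a (fv φ) ag)
    coincidence (ex v φ)   ag = Σ-cong-⇔ λ a → coincidence φ (agree-update v a (fv φ) ag)

    Sat-≗ : ∀ φ {ρ ρ'} → (∀ w → ρ w ≡ ρ' w) → Sat M ρ φ ⇔ Sat M ρ' φ
    Sat-≗ φ ρ≗ρ' = coincidence φ (λ w _ → ρ≗ρ' w)

    module _ {r : Var → Var} (r-inj : Injective _≡_ _≡_ r) where

      update-ren : ∀ ρ v a w → update M ρ (r v) a (r w) ≡ update M (ρ ∘ r) v a w
      update-ren ρ v a w rewrite sameVar-injective r-inj v w = refl

      ren-sat : ∀ φ ρ → Sat M ρ (ren r φ) ⇔ Sat M (ρ ∘ r) φ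
      ren-sat tt         ρ = ⇔.refl
      ren-sat ff         ρ = ⇔.refl
      ren-sat (eq t u)   ρ = ≡⇒⇔ (cong₂ _≡_ (eval-tmap ρ r t) (eval-tmap ρ r u))
      ren-sat (rel R ts) ρ = ≡⇒⇔ (cong (interpR R) (evalV-tmap ρ r ts))
      ren-sat (neg φ)    ρ = ¬-cong-⇔ (ren-sat φ ρ)
      ren-sat (and φ ψ)  ρ = ren-sat φ ρ ×-⇔ ren-sat ψ ρ
      ren-sat (or φ ψ)   ρ = ren-sat φ ρ ⊎-⇔ ren-sat ψ ρ
      ren-sat (imp φ ψ)  ρ = →-cong-⇔ (ren-sat φ ρ) (ren-sat ψ ρ)
      ren-sat (iff φ ψ)  ρ = →-cong-⇔ (ren-sat φ ρ) (ren-sat ψ ρ) ×-⇔ →-cong-⇔ (ren-sat ψ ρ) (ren-sat φ ρ)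
      ren-sat (all v φ)  ρ = Π-cong-⇔ λ a → ⇔.trans (ren-sat φ _) (Sat-≗ φ (update-ren ρ v a))
      ren-sat (ex v φ)   ρ = Σ-cong-⇔ λ a → ⇔.trans (ren-sat φ _) (Sat-≗ φ (update-ren ρ v a))

    shF-sat : ∀ k φ ρ → Sat M ρ (shF k φ) ⇔ Sat M (ρ ∘ shV k) φ
    shF-sat k φ ρ = ⇔.trans (≡⇒⇔ (cong (Sat M ρ) (shF≡ren k φ))) (ren-sat (shV-injective k) φ ρ)

    iff-intro : ∀ {ρ} φ ψ → Sat M ρ φ ⇔ Sat M ρ ψ → Sat M ρ (iff φ ψ)
    iff-intro φ ψ e = to e , from e

    iff-elim : ∀ {ρ} φ ψ → Sat M ρ (iff φ ψ) → Sat M ρ φ ⇔ Sat M ρ ψ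
    iff-elim φ ψ (f , g) = mk⇔ f g

    update-self : ∀ ρ v w → update M ρ v (ρ v) w ≡ ρ w
    update-self ρ v w with sameVar v w in e
    ... | true  = cong ρ (sameVar-≡ e)
    ... | false = refl

    update-other : ∀ ρ {v w} a → v ≢ w → update M ρ v a w ≡ ρ w
    update-other ρ a v≢w rewrite sameVar-≢ v≢w = refl

    allsT-elim : ∀ xs ψ ρ → Sat M ρ (allsT xs ψ) → Sat M ρ ψ
    allsT-elim []       ψ ρ s = s
    allsT-elim (x ∷ xs) ψ ρ s = to (Sat-≗ ψ (update-self ρ (tm x))) (allsT-elim xs ψ _ (s (ρ (tm x))))

    allsT-intro : ∀ xs ψ ρ → (∀ ρ' → (∀ q → ρ' (par q) ≡ ρ (par q)) → Sat M ρ' ψ) →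
                  Sat M ρ (allsT xs ψ)
    allsT-intro []       ψ ρ f   = f ρ (λ q → refl)
    allsT-intro (x ∷ xs) ψ ρ f a = allsT-intro xs ψ (update M ρ (tm x) a) f

    closeT-elim : ∀ ψ ρ → Sat M ρ (closeT ψ) → Sat M ρ ψ
    closeT-elim ψ = allsT-elim (fvT ψ) ψ

    closeT-intro : ∀ (h : PAssign M) ψ → (∀ s → Sat M (env M h s) ψ) → SatP M h (closeT ψ)
    closeT-intro h ψ f s = allsT-intro (fvT ψ) ψ (env M h s) λ ρ' same →
      to (Sat-≗ ψ (env-of ρ' same)) (f (ρ' ∘ tm))
      where
        env-of : ∀ ρ' → (∀ q → ρ' (par q) ≡ val h q) → ∀ w → env M h (ρ' ∘ tm) w ≡ ρ' w
        env-of ρ' same (par q) = sym (same q)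
        env-of ρ' same (tm x)  = refl

    exsT-elim : ∀ xs φ ρ → Sat M ρ (exsT xs φ) →
                Σ Env λ ρ' → Sat M ρ' φ × (∀ w → (∀ {y} → y ∈ xs → tm y ≢ w) → ρ' w ≡ ρ w)
    exsT-elim []       φ ρ s       = ρ , s , λ w _ → refl
    exsT-elim (x ∷ xs) φ ρ (a , s) =
      let (ρ' , s' , same) = exsT-elim xs φ (update M ρ (tm x) a) s
      in ρ' , s' , λ w outside →
           trans (same w (outside ∘ there)) (update-other ρ a (outside (here refl)))

    closed-SatP : ∀ φ → TeamClosed φ → ∀ {ρ} (h : PAssign M) →
                  (∀ q → ρ (par q) ≡ val h q) → Sat M ρ φ → SatP M h φ
    closed-SatP φ closed h same sat s = to (coincidence φ agree) sat
      where
        agree : Agree (fv φ) _ (env M h s)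
        agree (par q) _ = same q
        agree (tm x)  m = ⊥-elim (closed m)

    SatP-++ : ∀ xs ys {h} → SatP M h (conj (xs ++ ys)) → SatP M h (conj xs) × SatP M h (conj ys)
    SatP-++ xs ys sat = (λ s → proj₁ (split xs (sat s))) , (λ s → proj₂ (split xs (sat s)))
      where
        split : ∀ xs {ρ} → Sat M ρ (conj (xs ++ ys)) → Sat M ρ (conj xs) × Sat M ρ (conj ys)
        split []       s       = tt , s
        split (x ∷ xs) (a , s) = let (l , r) = split xs s in (a , l) , r

    Team : Set₁
    Team = (ℕ → Carrier) → Set

    team : PAssign M → Fm → Team
    team h γ s = Sat M (env M h s) γ

    infix 4 _≐_
    _≐_ : Team → Team → Set
    T ≐ T' = ∀ s → T s ⇔ T' s

    updateT : (ℕ → Carrier) → ℕ → Carrier → ℕ → Carrier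
    updateT s x a y = if sameVar (tm x) (tm y) then a else s y

    ∃T : ℕ → Team → Team
    ∃T x T s = Σ Carrier λ a → T (updateT s x a)

    ∃T-cong : ∀ x {T T'} → T ≐ T' → ∃T x T ≐ ∃T x T'
    ∃T-cong x T≐T' s = Σ-cong-⇔ λ a → T≐T' (updateT s x a)

    team-ex : ∀ h γ x → team h (ex (tm x) γ) ≐ ∃T x (team h γ)
    team-ex h γ x s = Σ-cong-⇔ λ a → Sat-≗ γ (pointwise a)
      where
        pointwise : ∀ a w → update M (env M h s) (tm x) a w ≡ env M h (updateT s x a) w
        pointwise a (par q) = refl
        pointwise a (tm y)  = refl

    TeamEnt : Team → IL → Set
    TeamEnt T (lit l) = ∀ s → T s → LitSat M s l
    TeamEnt T (indep t₁ t₂ t₃) =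
      ∀ s s' → T s → T s' → evs M s t₁ ≡ evs M s' t₁ →
      Σ (ℕ → Carrier) λ s'' → T s''
        × evs M s'' (t₁ ++ t₂) ≡ evs M s (t₁ ++ t₂)
        × evs M s'' (t₁ ++ t₃) ≡ evs M s' (t₁ ++ t₃)
    TeamEnt T (andI ψ₁ ψ₂) = TeamEnt T ψ₁ × TeamEnt T ψ₂
    TeamEnt T (orI ψ₁ ψ₂) =
      Σ (PAssign M) λ h₁ → Σ Fm λ θ₁ → Σ (PAssign M) λ h₂ → Σ Fm λ θ₂ →
        TeamEnt (team h₁ θ₁) ψ₁ × TeamEnt (team h₂ θ₂) ψ₂
        × (T ≐ λ s → team h₁ θ₁ s ⊎ team h₂ θ₂ s)
    TeamEnt T (exI x ψ) =
      Σ (PAssign M) λ h₁ → Σ Fm λ θ → TeamEnt (team h₁ θ) ψ × ∃T x (team h₁ θ) ≐ ∃T x T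
    TeamEnt T (allI x ψ) =
      Σ (PAssign M) λ h₁ → Σ Fm λ θ → TeamEnt (team h₁ θ) ψ × team h₁ θ ≐ ∃T x T

    TeamEnt-cong : ∀ φ {T T'} → T ≐ T' → TeamEnt T φ → TeamEnt T' φ
    TeamEnt-cong (lit l) T≐T' ent s t = ent s (from (T≐T' s) t)
    TeamEnt-cong (indep t₁ t₂ t₃) T≐T' ent s s' t t' e =
      let (s'' , t'' , e₂ , e₃) = ent s s' (from (T≐T' s) t) (from (T≐T' s') t') e
      in s'' , to (T≐T' s'') t'' , e₂ , e₃
    TeamEnt-cong (andI ψ₁ ψ₂) T≐T' (ent₁ , ent₂) =
      TeamEnt-cong ψ₁ T≐T' ent₁ , TeamEnt-cong ψ₂ T≐T' ent₂
    TeamEnt-cong (orI ψ₁ ψ₂) T≐T' (h₁ , θ₁ , h₂ , θ₂ , ent₁ , ent₂ , split) =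
      h₁ , θ₁ , h₂ , θ₂ , ent₁ , ent₂ , λ s → ⇔.trans (⇔.sym (T≐T' s)) (split s)
    TeamEnt-cong (exI x ψ) T≐T' (h₁ , θ , ent , proj) =
      h₁ , θ , ent , λ s → ⇔.trans (proj s) (∃T-cong x T≐T' s)
    TeamEnt-cong (allI x ψ) T≐T' (h₁ , θ , ent , proj) =
      h₁ , θ , ent , λ s → ⇔.trans (proj s) (∃T-cong x T≐T' s)

    eqs-intro : ∀ u (f g : Term ℕ → Term Var) {ρ} →
                map (eval M ρ ∘ f) u ≡ map (eval M ρ ∘ g) u → Sat M ρ (eqs (map f u) (map g u))
    eqs-intro []      f g e = tt
    eqs-intro (t ∷ u) f g e = proj₁ (∷-injective e) , eqs-intro u f g (proj₂ (∷-injective e))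

    eqs-elim : ∀ u (f g : Term ℕ → Term Var) {ρ} →
               Sat M ρ (eqs (map f u) (map g u)) → map (eval M ρ ∘ f) u ≡ map (eval M ρ ∘ g) u
    eqs-elim []      f g e        = refl
    eqs-elim (t ∷ u) f g (e , es) = cong₂ _∷_ e (eqs-elim u f g es)

    -- Given s, s' in the team of γ that agree on t̄₁,
    -- merge them into one assignment carrying s on copy 1 and s' on copy 2
    -- of the team variables; the premise of the axiom holds there, and the
    -- witness for its conclusion, read on copy 3, is the required s''.
    module IndependenceAxiom (γ : Fm) (t₁ t₂ t₃ : List (Term ℕ)) (h : PAssign M) where
      open IndAx γ t₁ t₂ t₃

      γ-below-N : ∀ {x} → tm x ∈ fv γ → x < N
      γ-below-N m = maxL-< (allT γ ++ tv) (∈-++⁺ˡ (fv⊆allT γ m))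

      terms-below-N : ∀ {t x} → t ∈ terms → x ∈ tvars t → x < N
      terms-below-N t∈ x∈ = maxL-< (allT γ ++ tv) (∈-++⁺ʳ (allT γ) (∈-concatMap⁺ tvars (lose t∈ x∈)))

      Copy : ℕ → Env → (ℕ → Carrier) → Set
      Copy k ρ σ = (∀ q → ρ (par q) ≡ val h q) × (∀ x → x < N → ρ (tm (x + k)) ≡ σ x)

      copy-γ : ∀ {k ρ σ} → Copy k ρ σ → Sat M ρ (shF k γ) ⇔ team h γ σ
      copy-γ {k} {ρ} {σ} (pars , block) = ⇔.trans (shF-sat k γ ρ) (coincidence γ agree)
        where
          agree : Agree (fv γ) (ρ ∘ shV k) (env M h σ)
          agree (par q) _ = pars q
          agree (tm x)  m = block x (γ-below-N m)

      copy-terms : ∀ {k ρ σ} u → u ⊆ terms → Copy k ρ σ →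
                   map (λ t → eval M ρ (tmap (shV k) (embT t))) u ≡ evs M σ u
      copy-terms {k} {ρ} {σ} u u⊆terms (_ , block) = map-cong-local (All.tabulate λ {t} t∈u → begin
          eval M ρ (tmap (shV k) (embT t))  ≡⟨ eval-tmap ρ (shV k) (embT t) ⟩
          eval M (ρ ∘ shV k) (embT t)       ≡⟨ eval-tmap (ρ ∘ shV k) tm t ⟩
          eval M (λ x → ρ (tm (x + k))) t   ≡⟨ eval-cong t (λ x x∈ → block x (terms-below-N (u⊆terms t∈u) x∈)) ⟩
          eval M σ t                        ∎)
        where open ≡-Reasoning

      t₁⊆terms : t₁ ⊆ terms
      t₁⊆terms = ∈-++⁺ˡ

      t₁t₂⊆terms : t₁ ++ t₂ ⊆ terms
      t₁t₂⊆terms = ∈-++-map {xs = t₁} {xs' = t₁} (λ m → m) ∈-++⁺ˡ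

      t₁t₃⊆terms : t₁ ++ t₃ ⊆ terms
      t₁t₃⊆terms = ∈-++-map {xs = t₁} {xs' = t₁} (λ m → m) (∈-++⁺ʳ t₂)

      copies-below-3N : ∀ {x} → x < N → x + 1 * N < 3 * N × x + 2 * N < 3 * N
      copies-below-3N x<N = <-≤-trans (+-monoˡ-< (1 * N) x<N) (m≤n+m (2 * N) N) , +-monoˡ-< (2 * N) x<N

      conclusion-witness : ∀ {ρ s s'} → Copy (1 * N) ρ s → Copy (2 * N) ρ s' →
        Sat M ρ (exsT (map (λ x → x + 3 * N) vs) conclusion) →
        Σ (ℕ → Carrier) λ s'' → team h γ s''
          × evs M s'' (t₁ ++ t₂) ≡ evs M s (t₁ ++ t₂)
          × evs M s'' (t₁ ++ t₃) ≡ evs M s' (t₁ ++ t₃)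
      conclusion-witness {ρ} {s} {s'} copy₁ copy₂ holds =
        s'' , to (copy-γ copy₃) (proj₁ concl) , agrees₂ , agrees₃
        where
          witness = exsT-elim (map (λ x → x + 3 * N) vs) conclusion ρ holds
          ρ₃     = proj₁ witness
          concl  = proj₁ (proj₂ witness)
          keeps  = proj₂ (proj₂ witness)

          -- the existential witnesses only touch team variables from 3N upwards
          keeps-below-3N : ∀ {x} → x < 3 * N → ρ₃ (tm x) ≡ ρ (tm x)
          keeps-below-3N {x} x<3N = keeps (tm x) λ y∈ e → above (∈-map⁻ (λ z → z + 3 * N) y∈) e
            where
              above : ∀ {y} → Σ ℕ (λ z → z ∈ vs × y ≡ z + 3 * N) → tm y ≢ tm x
              above (z , _ , refl) e = ≤⇒≯ (subst (3 * N ≤_) (tm-injective e) (m≤n+m (3 * N) z)) x<3N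

          s'' : ℕ → Carrier
          s'' x = ρ₃ (tm (x + 3 * N))

          pars₃ : ∀ q → ρ₃ (par q) ≡ val h q
          pars₃ q = trans (keeps (par q) λ _ ()) (proj₁ copy₁ q)

          copy₃ : Copy (3 * N) ρ₃ s''
          copy₃ = pars₃ , λ x _ → refl

          copy₁' : Copy (1 * N) ρ₃ s
          copy₁' = pars₃ , λ x x<N →
            trans (keeps-below-3N (proj₁ (copies-below-3N x<N))) (proj₂ copy₁ x x<N)

          copy₂' : Copy (2 * N) ρ₃ s'
          copy₂' = pars₃ , λ x x<N →
            trans (keeps-below-3N (proj₂ (copies-below-3N x<N))) (proj₂ copy₂ x x<N)

          agrees₂ : evs M s'' (t₁ ++ t₂) ≡ evs M s (t₁ ++ t₂)
          agrees₂ = trans (sym (copy-terms (t₁ ++ t₂) t₁t₂⊆terms copy₃))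
                    (trans (eqs-elim (t₁ ++ t₂) _ _ (proj₁ (proj₂ concl)))
                           (copy-terms (t₁ ++ t₂) t₁t₂⊆terms copy₁'))

          agrees₃ : evs M s'' (t₁ ++ t₃) ≡ evs M s' (t₁ ++ t₃)
          agrees₃ = trans (sym (copy-terms (t₁ ++ t₃) t₁t₃⊆terms copy₃))
                    (trans (eqs-elim (t₁ ++ t₃) _ _ (proj₂ (proj₂ concl)))
                           (copy-terms (t₁ ++ t₃) t₁t₃⊆terms copy₂'))

      merged : (s s' : ℕ → Carrier) → Env
      merged s s' = env M h (merge3 N (λ _ → point) s s')

      merged-copy₁ : ∀ s s' → Copy (1 * N) (merged s s') s
      merged-copy₁ s s' = (λ q → refl) , λ x x<N → merge3-second N _ s s' x<N

      merged-copy₂ : ∀ s s' → Copy (2 * N) (merged s s') s'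
      merged-copy₂ s s' = (λ q → refl) , λ x x<N → merge3-third N _ s s' x<N

      premise-holds : ∀ {s s'} → team h γ s → team h γ s' → evs M s t₁ ≡ evs M s' t₁ →
                      Sat M (merged s s') premise
      premise-holds {s} {s'} γs γs' same-t₁ =
        from (copy-γ copy₁) γs , from (copy-γ copy₂) γs' ,
        eqs-intro t₁ _ _ (trans (copy-terms t₁ t₁⊆terms copy₁)
                          (trans same-t₁ (sym (copy-terms t₁ t₁⊆terms copy₂))))
        where
          copy₁ = merged-copy₁ s s'
          copy₂ = merged-copy₂ s s'

      axiom-sound : SatP M h (indAx γ t₁ t₂ t₃) → TeamEnt (team h γ) (indep t₁ t₂ t₃)
      axiom-sound ax s s' γs γs' same-t₁ =
        conclusion-witness (merged-copy₁ s s') (merged-copy₂ s s')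
          (closeT-elim body (merged s s') (ax _) (premise-holds γs γs' same-t₁))

    litFm-sat : ∀ {h s} l → Sat M (env M h s) (litFm l) → LitSat M s l
    litFm-sat {h} {s} (eqL t u)    rewrite eval-tmap (env M h s) tm t | eval-tmap (env M h s) tm u = λ p → p
    litFm-sat {h} {s} (neqL t u)   rewrite eval-tmap (env M h s) tm t | eval-tmap (env M h s) tm u = λ p → p
    litFm-sat {h} {s} (relL R ts)  rewrite evalV-tmap (env M h s) tm ts = λ p → p
    litFm-sat {h} {s} (nrelL R ts) rewrite evalV-tmap (env M h s) tm ts = λ p → p

    closeT-iff-team : ∀ {h} φ ψ → SatP M h (conj (closeT (iff φ ψ) ∷ [])) → team h φ ≐ team h ψ
    closeT-iff-team {h} φ ψ sat s = iff-elim φ ψ (closeT-elim (iff φ ψ) (env M h s) (proj₁ (sat s)))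

    -- Every rule is sound for the relaxed semantics, with all witnesses read
    -- under the parameter assignment h itself (except for PS-depar).
    sound : ∀ {Γ γ φ} → Γ ∣ γ ⊢ φ → ∀ h → SatP M h (conj Γ) → TeamEnt (team h γ) φ
    sound (ps-lit γ l) h sat s γs =
      litFm-sat l (closeT-elim (imp γ (litFm l)) (env M h s) (proj₁ (sat s)) γs)
    sound (ps-ind γ t₁ t₂ t₃) h sat =
      IndependenceAxiom.axiom-sound γ t₁ t₂ t₃ h (proj₁ ∘ sat)
    sound (ps-or {Γ₁} {Γ₂} {γ₁} {γ₂} γ d e) h sat =
      h , γ₁ , h , γ₂ , sound d h sat₁ , sound e h sat₂ , closeT-iff-team γ (or γ₁ γ₂) axiom
      where
        sat₁  = proj₁ (SatP-++ Γ₁ _ sat)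
        sat₂  = proj₁ (SatP-++ Γ₂ _ (proj₂ (SatP-++ Γ₁ _ sat)))
        axiom = proj₂ (SatP-++ Γ₂ _ (proj₂ (SatP-++ Γ₁ _ sat)))
    sound (ps-and {Γ₁} {Γ₂} d e) h sat =
      sound d h (proj₁ (SatP-++ Γ₁ Γ₂ sat)) , sound e h (proj₂ (SatP-++ Γ₁ Γ₂ sat))
    sound (ps-ex {Γ} {γ'} γ x d) h sat =
      h , γ' , sound d h (proj₁ (SatP-++ Γ _ sat)) , λ s → begin
        ∃T x (team h γ') s       ≈⟨ team-ex h γ' x s ⟨
        team h (ex (tm x) γ') s  ≈⟨ closeT-iff-team (ex (tm x) γ') (ex (tm x) γ) axiom s ⟩
        team h (ex (tm x) γ) s   ≈⟨ team-ex h γ x s ⟩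
        ∃T x (team h γ) s        ∎
      where
        open ⇔-Reasoning
        axiom = proj₂ (SatP-++ Γ _ sat)
    sound (ps-all {Γ} {γ'} γ x d) h sat =
      h , γ' , sound d h (proj₁ (SatP-++ Γ _ sat)) , λ s → begin
        team h γ' s              ≈⟨ closeT-iff-team γ' (ex (tm x) γ) axiom s ⟩
        team h (ex (tm x) γ) s   ≈⟨ team-ex h γ x s ⟩
        ∃T x (team h γ) s        ∎
      where
        open ⇔-Reasoning
        axiom = proj₂ (SatP-++ Γ _ sat)
    sound (ps-ent Γ' d _ Γ'⊨Γ) h sat = sound d h (λ s → Γ'⊨Γ M (env M h s) (sat s))
    -- the witness a for p can be fixed once and for all, as Γ has no team
    -- variables; changing p does not affect γ
    sound (ps-depar {Γ} {γ} {φ} p d p∉γ) h sat =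
      TeamEnt-cong φ (λ s → coincidence γ (agree s)) (sound d hₚ satₚ)
      where
        ρ₀ : Env
        ρ₀ = env M h (λ _ → point)
        a       = proj₁ (proj₁ (sat (λ _ → point)))
        Γ-holds = proj₂ (proj₁ (sat (λ _ → point)))
        hₚ : PAssign M
        hₚ = record { dom = dom h ; val = update M ρ₀ (par p) a ∘ par }
        satₚ : SatP M hₚ (conj Γ)
        satₚ = closed-SatP (conj Γ) (context-closed d) hₚ (λ q → refl) Γ-holds
        p-fresh : ∀ {q} → par q ∈ fv γ → par p ≢ par q
        p-fresh m e = p∉γ (subst (_∈ fvP γ) (sym (par-injective e)) (parsOf-∈ (fv γ) m))
        agree : ∀ s → Agree (fv γ) (env M hₚ s) (env M h s)
        agree s (tm x)  _ = refl
        agree s (par q) m = update-other ρ₀ a (p-fresh m)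
    -- the disjunct can be chosen once and for all, as the Γᵢ have no team variables
    sound (ps-split {Γ₁} {Γ₂} d e) h sat with proj₁ (sat (λ _ → point))
    ... | inj₁ Γ₁-holds = sound d h (closed-SatP (conj Γ₁) (context-closed d) h (λ q → refl) Γ₁-holds)
    ... | inj₂ Γ₂-holds = sound e h (closed-SatP (conj Γ₂) (context-closed e) h (λ q → refl) Γ₂-holds)

    -- Amalgamation of the parameter assignments h, h₁, h₂: the parameters of
    -- θ₁ and θ₂ are shifted into two fresh blocks above everything h, γ, θ₁,
    -- θ₂ use, so one extension h' of h reads γ, θ₁, θ₂ as h, h₁, h₂ do.
    module Amalgamation (h : PAssign M) (γ : Fm) (h₁ : PAssign M) (θ₁ : Fm) (h₂ : PAssign M) (θ₂ : Fm) where
      used : List ℕ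
      used = dom h ++ fvP γ ++ fvP θ₁ ++ fvP θ₂

      K : ℕ
      K = suc (maxL used)

      γ₁ : Fm
      γ₁ = ren (shP (1 * K)) θ₁

      γ₂ : Fm
      γ₂ = ren (shP (2 * K)) θ₂

      h' : PAssign M
      h' = record { dom = dom h ++ fvP γ₁ ++ fvP γ₂ ; val = merge3 K (val h) (val h₁) (val h₂) }

      extends : Extends M h h'
      extends = ∈-++⁺ˡ , λ p p∈ → merge3-first K (val h) (val h₁) (val h₂) (maxL-< used (∈-++⁺ˡ p∈))

      γ₁-pars : fvP γ₁ ⊆ dom h'
      γ₁-pars = ∈-++⁺ʳ (dom h) ∘ ∈-++⁺ˡ

      γ₂-pars : fvP γ₂ ⊆ dom h'
      γ₂-pars = ∈-++⁺ʳ (dom h) ∘ ∈-++⁺ʳ (fvP γ₁)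

      team-γ : team h' γ ≐ team h γ
      team-γ s = coincidence γ agree
        where
          agree : Agree (fv γ) (env M h' s) (env M h s)
          agree (par q) m = merge3-first K (val h) (val h₁) (val h₂)
            (maxL-< used (∈-++⁺ʳ (dom h) (∈-++⁺ˡ (parsOf-∈ (fv γ) m))))
          agree (tm x)  _ = refl

      team-γ₁ : team h' γ₁ ≐ team h₁ θ₁
      team-γ₁ s = ⇔.trans (ren-sat (shP-injective (1 * K)) θ₁ (env M h' s)) (coincidence θ₁ agree)
        where
          agree : Agree (fv θ₁) (env M h' s ∘ shP (1 * K)) (env M h₁ s)
          agree (par q) m = merge3-second K (val h) (val h₁) (val h₂)
            (maxL-< used (∈-++⁺ʳ (dom h) (∈-++⁺ʳ (fvP γ) (∈-++⁺ˡ (parsOf-∈ (fv θ₁) m)))))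
          agree (tm x)  _ = refl

      team-γ₂ : team h' γ₂ ≐ team h₂ θ₂
      team-γ₂ s = ⇔.trans (ren-sat (shP-injective (2 * K)) θ₂ (env M h' s)) (coincidence θ₂ agree)
        where
          agree : Agree (fv θ₂) (env M h' s ∘ shP (2 * K)) (env M h₂ s)
          agree (par q) m = merge3-third K (val h) (val h₁) (val h₂)
            (maxL-< used (∈-++⁺ʳ (dom h) (∈-++⁺ʳ (fvP γ) (∈-++⁺ʳ (fvP θ₁) (parsOf-∈ (fv θ₂) m)))))
          agree (tm x)  _ = refl

    -- The relaxed semantics implies the entailment semantics.  At a
    -- quantifier only one witness is amalgamated, so it is passed twice.
    TeamEnt⇒Ent : ∀ φ {T} → TeamEnt T φ → ∀ h γ → T ≐ team h γ → Ent M γ h φ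
    TeamEnt⇒Ent (lit l) ent h γ T≐ s γs = ent s (from (T≐ s) γs)
    TeamEnt⇒Ent (indep t₁ t₂ t₃) ent h γ T≐ s s' γs γs' same-t₁ =
      let (s'' , t'' , e₂ , e₃) = ent s s' (from (T≐ s) γs) (from (T≐ s') γs') same-t₁
      in s'' , to (T≐ s'') t'' , e₂ , e₃
    TeamEnt⇒Ent (andI ψ₁ ψ₂) (ent₁ , ent₂) h γ T≐ =
      TeamEnt⇒Ent ψ₁ ent₁ h γ T≐ , TeamEnt⇒Ent ψ₂ ent₂ h γ T≐
    TeamEnt⇒Ent (orI ψ₁ ψ₂) {T} (h₁ , θ₁ , h₂ , θ₂ , ent₁ , ent₂ , split) h γ T≐ =
      h' , extends , γ₁ , γ₂ , γ₁-pars , γ₂-pars ,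
      TeamEnt⇒Ent ψ₁ ent₁ h' γ₁ (⇔.sym ∘ team-γ₁) ,
      TeamEnt⇒Ent ψ₂ ent₂ h' γ₂ (⇔.sym ∘ team-γ₂) ,
      closeT-intro h' (iff γ (or γ₁ γ₂)) λ s → iff-intro γ (or γ₁ γ₂) (begin
        team h' γ s                   ≈⟨ team-γ s ⟩
        team h γ s                    ≈⟨ T≐ s ⟨
        T s                           ≈⟨ split s ⟩
        (team h₁ θ₁ s ⊎ team h₂ θ₂ s) ≈⟨ team-γ₁ s ⊎-⇔ team-γ₂ s ⟨
        (team h' γ₁ s ⊎ team h' γ₂ s) ∎)
      where
        open Amalgamation h γ h₁ θ₁ h₂ θ₂
        open ⇔-Reasoning
    TeamEnt⇒Ent (exI x ψ) {T} (h₁ , θ , ent , proj) h γ T≐ =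
      h' , extends , γ₁ , γ₁-pars ,
      TeamEnt⇒Ent ψ ent h' γ₁ (⇔.sym ∘ team-γ₁) ,
      closeT-intro h' (iff (ex (tm x) γ₁) (ex (tm x) γ)) λ s →
        iff-intro (ex (tm x) γ₁) (ex (tm x) γ) (begin
          team h' (ex (tm x) γ₁) s  ≈⟨ team-ex h' γ₁ x s ⟩
          ∃T x (team h' γ₁) s       ≈⟨ ∃T-cong x team-γ₁ s ⟩
          ∃T x (team h₁ θ) s        ≈⟨ proj s ⟩
          ∃T x T s                  ≈⟨ ∃T-cong x T≐ s ⟩
          ∃T x (team h γ) s         ≈⟨ ∃T-cong x team-γ s ⟨
          ∃T x (team h' γ) s        ≈⟨ team-ex h' γ x s ⟨
          team h' (ex (tm x) γ) s   ∎)
      where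
        open Amalgamation h γ h₁ θ h₁ θ
        open ⇔-Reasoning
    TeamEnt⇒Ent (allI x ψ) {T} (h₁ , θ , ent , proj) h γ T≐ =
      h' , extends , γ₁ , γ₁-pars ,
      TeamEnt⇒Ent ψ ent h' γ₁ (⇔.sym ∘ team-γ₁) ,
      closeT-intro h' (iff γ₁ (ex (tm x) γ)) λ s → iff-intro γ₁ (ex (tm x) γ) (begin
        team h' γ₁ s              ≈⟨ team-γ₁ s ⟩
        team h₁ θ s               ≈⟨ proj s ⟩
        ∃T x T s                  ≈⟨ ∃T-cong x T≐ s ⟩
        ∃T x (team h γ) s         ≈⟨ ∃T-cong x team-γ s ⟨
        ∃T x (team h' γ) s        ≈⟨ team-ex h' γ x s ⟨
        team h' (ex (tm x) γ) s   ∎)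
      where
        open Amalgamation h γ h₁ θ h₁ θ
        open ⇔-Reasoning

mainTheorem1 : (S : Signature) → let open Syntax S in
    (Γ : List Fm) (γ : Fm) (φ : IL) → Γ ∣ γ ⊢ φ → Valid Γ γ φ
mainTheorem1 S Γ γ φ d M h _ Γ-holds =
  TeamEnt⇒Ent φ (sound d h Γ-holds) h γ (λ s → ⇔.refl)
  where
    open Soundness S
    open Semantics M
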